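{- Let $n\ge2$. A necklace of size two is topdrop-valid in $S_n$ if and only if it is equivalent (up to cyclic rotation) to $[n-1,n]$.
   Context: Permutations are in one-line notation $\pi=\pi_1\cdots\pi_n$. The topdrop map $T:S_n\to S_n$ is $T(\pi_1\cdots\pi_n)=\pi_{\pi_1+1}\cdots\pi_n\,\pi_{\pi_1}\pi_{\pi_1-1}\cdots\pi_1$ (first $\pi_1$ entries removed, reversed, appended at the end); it is a bijection. The orbit of $\pi$ is $(\pi,T(\pi),\dots,T^{s-1}(\pi))$ with $s\ge1$ minimal such that $T^s(\pi)=\pi$. The topdrop-necklace of $\pi$ is the cyclic sequence $[\pi_1,T(\pi)_1,\dots,T^{s-1}(\pi)_1]$, considered up to cyclic rotation (two necklaces are equivalent if they differ by a rotation); its size is $s$. A necklace is topdrop-valid in $S_n$ if it is the topdrop-necklace of some $\pi\in S_n$. -}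

module Defs where

open import Data.Nat using (ℕ; zero; suc; _≤_; _<_)
open import Data.List using (List; []; _∷_; _++_; take; drop; reverse; map; upTo; length)
open import Data.List.Relation.Binary.Permutation.Propositional using (_↭_)
open import Data.Product using (Σ; _×_; ∃; ∃-syntax)
open import Relation.Binary.PropositionalEquality using (_≡_; _≢_)

-- A permutation π ∈ S_n in one-line notation: a list that is a rearrangement of [1,…,n].
IsPerm : ℕ → List ℕ → Set
IsPerm n π = π ↭ map suc (upTo n)

-- first entry (default 0 for the empty list; irrelevant for n ≥ 1)
first : List ℕ → ℕ
first []      = 0
first (x ∷ _) = x

topdrop : List ℕ → List ℕ
topdrop π = drop (first π) π ++ reverse (take (first π) π)

topdrop^ : ℕ → List ℕ → List ℕ
topdrop^ zero    π = π
topdrop^ (suc k) π = topdrop (topdrop^ k π)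

OrbitSize : List ℕ → ℕ → Set
OrbitSize π s = (1 ≤ s) × (topdrop^ s π ≡ π) × (∀ t → 1 ≤ t → t < s → topdrop^ t π ≢ π)

necklaceSeq : List ℕ → ℕ → List ℕ
necklaceSeq π s = map (λ i → first (topdrop^ i π)) (upTo s)

rotate : ℕ → List ℕ → List ℕ
rotate k xs = drop k xs ++ take k xs

_∼ᶜ_ : List ℕ → List ℕ → Set
xs ∼ᶜ ys = ∃[ k ] (k < length xs × rotate k xs ≡ ys)

IsTopdropNecklaceOf : List ℕ → List ℕ → Set
IsTopdropNecklaceOf N π = ∃[ s ] (OrbitSize π s × necklaceSeq π s ∼ᶜ N)

TopdropValid : ℕ → List ℕ → Set
TopdropValid n N = ∃[ π ] (IsPerm n π × IsTopdropNecklaceOf N π)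

{-# OPTIONS --safe #-}
module Submission where

open import Defs
open import Data.Nat using (ℕ; zero; suc; _≤_; _<_; _∸_; z≤n; s≤s; _<?_)
open import Data.Nat.Properties
  using (suc-injective; ≤-refl; ≤-reflexive; ≮⇒≥; n∸n≡0; 1+n≢n)
open import Data.List using (List; []; _∷_; _++_; _∷ʳ_; [_]; take; drop; reverse; map; upTo; length)
open import Data.List.Properties
  using ( ∷-injectiveʳ; ++-assoc; ++-identityʳ; map-++; length-map; length-upTo; upTo-∷ʳ
        ; length-drop; length-reverse; length-++-comm; unfold-reverse; reverse-involutive
        ; take++drop≡id; take-all; drop-all )
open import Data.List.Relation.Binary.Permutation.Propositional
  using (_↭_; ↭-sym; ↭-trans; ↭⇒↭ₛ; module PermutationReasoning)
open import Data.List.Relation.Binary.Permutation.Propositional.Properties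
  using (↭-length; ↭-reverse; ++-comm; ++⁺ʳ; shift; ∈-resp-↭)
import Data.List.Relation.Binary.Permutation.Setoid.Properties as SetoidPerm
import Data.List.Relation.Unary.All as All
import Data.List.Relation.Unary.All.Properties as All
open import Data.List.Relation.Unary.AllPairs using (_∷_)
open import Data.List.Relation.Unary.Any using (here; there)
open import Data.List.Relation.Unary.Unique.Propositional using (Unique)
import Data.List.Relation.Unary.Unique.Propositional.Properties as Unique
open import Data.List.Membership.Propositional using (_∈_)
open import Data.List.Membership.Propositional.Properties using (∈-++⁺ʳ; ∈-map⁻; ∈-upTo⁻)
open import Data.Product using (_×_; _,_; proj₁; proj₂)
open import Data.Sum as Sum using (_⊎_; inj₁; inj₂)
open import Function.Bundles using (_⇔_; mk⇔)
open import Relation.Nullary using (yes; no; contradiction)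
open import Relation.Binary.PropositionalEquality
  using (_≡_; _≢_; refl; sym; trans; cong; cong₂; subst; setoid; module ≡-Reasoning)

-- Write π = A ++ B with |A| = π₁, so that σ = T(π) = B ++ rev A, and suppose
-- T(σ) = π.  If σ₁ < |B|, then T(σ)₁ would be an entry of B, yet T(σ)₁ = π₁ lies
-- in A; so σ₁ ≥ |B| and T(σ) ends with rev B.  Comparing with π, the block B is
-- a palindrome without repeated entries, so |B| ≤ 1, i.e. π₁ ≥ n − 1.  The same
-- holds for σ, and σ₁ ≠ π₁, so {π₁, σ₁} = {n − 1, n}.  Conversely
-- π = (n−1) 1 2 ⋯ (n−2) n is a 2-cycle: T(π) = n (n−2) ⋯ 1 (n−1).

topdropAt : ℕ → List ℕ → List ℕ
topdropAt k xs = drop k xs ++ reverse (take k xs)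

topdropAt-↭ : ∀ k xs → topdropAt k xs ↭ xs
topdropAt-↭ k xs = begin
  drop k xs ++ reverse (take k xs)  ↭⟨ ++-comm (drop k xs) (reverse (take k xs)) ⟩
  reverse (take k xs) ++ drop k xs  ↭⟨ ++⁺ʳ (drop k xs) (↭-reverse (take k xs)) ⟩
  take k xs ++ drop k xs            ≡⟨ take++drop≡id k xs ⟩
  xs                                ∎
  where open PermutationReasoning

length-topdropAt : ∀ k xs → length (topdropAt k xs) ≡ length xs
length-topdropAt k xs = ↭-length (topdropAt-↭ k xs)

topdropAt-suc : ∀ k x xs → topdropAt (suc k) (x ∷ xs) ≡ topdropAt k xs ++ [ x ]
topdropAt-suc k x xs = begin
  drop k xs ++ reverse (x ∷ take k xs)        ≡⟨ cong (drop k xs ++_) (unfold-reverse x (take k xs)) ⟩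
  drop k xs ++ (reverse (take k xs) ++ [ x ]) ≡⟨ ++-assoc (drop k xs) (reverse (take k xs)) [ x ] ⟨
  topdropAt k xs ++ [ x ]                     ∎
  where open ≡-Reasoning

topdropAt-++ : ∀ {k} B R → length B ≤ k → topdropAt k (B ++ R) ≡ topdropAt (k ∸ length B) R ++ reverse B
topdropAt-++ [] R _ = sym (++-identityʳ _)
topdropAt-++ {suc k} (x ∷ B) R (s≤s |B|≤k) = begin
  topdropAt (suc k) (x ∷ B ++ R)           ≡⟨ topdropAt-suc k x (B ++ R) ⟩
  topdropAt k (B ++ R) ++ [ x ]            ≡⟨ cong (_++ [ x ]) (topdropAt-++ B R |B|≤k) ⟩
  (rest ++ reverse B) ++ [ x ]             ≡⟨ ++-assoc rest (reverse B) [ x ] ⟩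
  rest ++ (reverse B ++ [ x ])             ≡⟨ cong (rest ++_) (unfold-reverse x B) ⟨
  rest ++ reverse (x ∷ B)                  ∎
  where
  open ≡-Reasoning
  rest : List ℕ
  rest = topdropAt (k ∸ length B) R

topdropAt-length : ∀ B R → topdropAt (length B) (B ++ R) ≡ R ++ reverse B
topdropAt-length B R = begin
  topdropAt (length B) (B ++ R)                  ≡⟨ topdropAt-++ B R ≤-refl ⟩
  topdropAt (length B ∸ length B) R ++ reverse B ≡⟨ cong (λ j → topdropAt j R ++ reverse B) (n∸n≡0 (length B)) ⟩
  (R ++ []) ++ reverse B                         ≡⟨ cong (_++ reverse B) (++-identityʳ R) ⟩
  R ++ reverse B                                 ∎
  where open ≡-Reasoning

topdrop-all : ∀ xs → length xs ≤ first xs → topdrop xs ≡ reverse xs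
topdrop-all xs |xs|≤x₁ =
  cong₂ _++_ (drop-all (first xs) xs |xs|≤x₁) (cong reverse (take-all (first xs) xs |xs|≤x₁))

topdrop-∷-++ : ∀ {k} xs ys → length xs ≡ k → topdrop (suc k ∷ xs ++ ys) ≡ ys ++ reverse (suc k ∷ xs)
topdrop-∷-++ {k} xs ys refl = topdropAt-length (suc k ∷ xs) ys

first-drop-++-∈ : ∀ {k} B R ys → k < length B → first (drop k (B ++ R) ++ ys) ∈ B
first-drop-++-∈ {zero}  (x ∷ B) R ys _             = here refl
first-drop-++-∈ {suc k} (x ∷ B) R ys (s≤s k<|B|) = there (first-drop-++-∈ B R ys k<|B|)

first-topdropAt-suc-∈ : ∀ k x xs → 1 ≤ length xs → first (topdropAt (suc k) (x ∷ xs)) ∈ xs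
first-topdropAt-suc-∈ k x xs 1≤|xs| =
  subst (_∈ xs) (cong first (sym (topdropAt-suc k x xs)))
    (∈-resp-↭ (topdropAt-↭ k xs) (first-++-∈ (topdropAt k xs) 1≤|ys|))
  where
  1≤|ys| : 1 ≤ length (topdropAt k xs)
  1≤|ys| = subst (1 ≤_) (sym (length-topdropAt k xs)) 1≤|xs|
  first-++-∈ : ∀ ys {zs} → 1 ≤ length ys → first (ys ++ zs) ∈ ys
  first-++-∈ (y ∷ ys) _ = here refl

++-cancelˡ-length : ∀ xs ys {zs ws : List ℕ} → length xs ≡ length ys → xs ++ zs ≡ ys ++ ws → zs ≡ ws
++-cancelˡ-length []       []       _   eq = eq
++-cancelˡ-length (x ∷ xs) (y ∷ ys) len eq = ++-cancelˡ-length xs ys (suc-injective len) (∷-injectiveʳ eq)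

∷ʳ≡∷⇒∈ : ∀ {x : ℕ} {ys} rs → rs ∷ʳ x ≡ x ∷ ys → ys ≢ [] → x ∈ ys
∷ʳ≡∷⇒∈ []       eq ys≢[] = contradiction (sym (∷-injectiveʳ eq)) ys≢[]
∷ʳ≡∷⇒∈ (r ∷ rs) eq _     = subst (_ ∈_) (∷-injectiveʳ eq) (∈-++⁺ʳ rs (here refl))

palindrome-length≤1 : ∀ {xs : List ℕ} → Unique xs → reverse xs ≡ xs → length xs ≤ 1
palindrome-length≤1 {[]}              _ _ = z≤n
palindrome-length≤1 {x ∷ []}          _ _ = s≤s z≤n
palindrome-length≤1 {x ∷ xs@(_ ∷ _)} u rev≡ =
  contradiction (∷ʳ≡∷⇒∈ (reverse xs) (trans (sym (unfold-reverse x xs)) rev≡) (λ ()))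
                (Unique.Unique[x∷xs]⇒x∉xs u)

length-drop-first≤1 : ∀ {π} → Unique π → 1 ≤ first π → topdrop (topdrop π) ≡ π → length (drop (first π) π) ≤ 1
length-drop-first≤1 {π@(suc a ∷ rest)} (π₁∉rest ∷ unique-rest) _ T²π≡π
  with first (topdrop π) <? length (drop a rest)
... | yes σ₁<|B| =
  contradiction (sym (cong first T²π≡π))
    (All.lookup (All.drop⁺ a π₁∉rest) (first-drop-++-∈ (drop a rest) _ _ σ₁<|B|))
... | no σ₁≮|B| = palindrome-length≤1 (Unique.drop⁺ a unique-rest) rev-B≡B
  where
  A B : List ℕ
  A = take (suc a) π
  B = drop a rest
  k : ℕ
  k = first (topdrop π) ∸ length B
  rev-B≡B : reverse B ≡ B
  rev-B≡B = ++-cancelˡ-length (topdropAt k (reverse A)) A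
    (trans (length-topdropAt k (reverse A)) (length-reverse A))
    (begin
      topdropAt k (reverse A) ++ reverse B ≡⟨ topdropAt-++ B (reverse A) (≮⇒≥ σ₁≮|B|) ⟨
      topdrop (topdrop π)                  ≡⟨ T²π≡π ⟩
      π                                    ≡⟨ take++drop≡id (suc a) π ⟨
      A ++ B                               ∎)
    where open ≡-Reasoning

IsPerm-length : ∀ {n π} → IsPerm n π → length π ≡ n
IsPerm-length {n} perm = trans (↭-length perm) (trans (length-map suc (upTo n)) (length-upTo n))

IsPerm-unique : ∀ {n π} → IsPerm n π → Unique π
IsPerm-unique {n} perm =
  SetoidPerm.Unique-resp-↭ (setoid ℕ) (↭⇒↭ₛ (↭-sym perm)) (Unique.map⁺ suc-injective (Unique.upTo⁺ n))

IsPerm-topdrop : ∀ {n π} → IsPerm n π → IsPerm n (topdrop π)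
IsPerm-topdrop {π = π} perm = ↭-trans (topdropAt-↭ (first π) π) perm

IsPerm-first : ∀ {m π} → IsPerm (suc m) π → 1 ≤ first π × first π ≤ suc m
IsPerm-first {π = []}    perm = contradiction (IsPerm-length perm) λ ()
IsPerm-first {π = x ∷ _} perm
  with i , i<m , refl ← ∈-map⁻ suc (∈-resp-↭ perm (here refl)) = s≤s z≤n , ∈-upTo⁻ i<m

near-top : ∀ m a → a ≤ suc m → suc m ∸ a ≤ 1 → a ≡ m ⊎ a ≡ suc m
near-top zero    zero          _         _ = inj₁ refl
near-top zero    (suc zero)    _         _ = inj₂ refl
near-top zero    (suc (suc a)) (s≤s ())  _
near-top (suc m) zero          _         (s≤s ())
near-top (suc m) (suc a)       (s≤s a≤m) h = Sum.map (cong suc) (cong suc) (near-top m a a≤m h)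

first-of-2-cycle : ∀ {m π} → IsPerm (suc m) π → topdrop (topdrop π) ≡ π → first π ≡ m ⊎ first π ≡ suc m
first-of-2-cycle {m} {π} perm T²π≡π =
  near-top m (first π) π₁≤n
    (subst (_≤ 1) |B|≡n∸π₁ (length-drop-first≤1 (IsPerm-unique perm) 1≤π₁ T²π≡π))
  where
  1≤π₁ : 1 ≤ first π
  1≤π₁ = IsPerm-first perm .proj₁
  π₁≤n : first π ≤ suc m
  π₁≤n = IsPerm-first perm .proj₂
  |B|≡n∸π₁ : length (drop (first π) π) ≡ suc m ∸ first π
  |B|≡n∸π₁ = trans (length-drop (first π) π) (cong (_∸ first π) (IsPerm-length perm))

first-topdrop≢first : ∀ {π} → Unique π → 1 ≤ first π → 2 ≤ length π → first (topdrop π) ≢ first π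
first-topdrop≢first {suc k ∷ xs} (π₁∉xs ∷ _) _ (s≤s 1≤|xs|) σ₁≡π₁ =
  All.lookup π₁∉xs (first-topdropAt-suc-∈ k (suc k) xs 1≤|xs|) (sym σ₁≡π₁)

∼ᶜ-pair-refl : ∀ {x y} → (x ∷ y ∷ []) ∼ᶜ (x ∷ y ∷ [])
∼ᶜ-pair-refl = 0 , s≤s z≤n , refl

∼ᶜ-pair-swap : ∀ {x y} → (x ∷ y ∷ []) ∼ᶜ (y ∷ x ∷ [])
∼ᶜ-pair-swap = 1 , s≤s (s≤s z≤n) , refl

∼ᶜ-pair-cases : ∀ {x y zs} → (x ∷ y ∷ []) ∼ᶜ zs → zs ≡ x ∷ y ∷ [] ⊎ zs ≡ y ∷ x ∷ []
∼ᶜ-pair-cases (0 , _ , refl) = inj₁ refl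
∼ᶜ-pair-cases (1 , _ , refl) = inj₂ refl
∼ᶜ-pair-cases (suc (suc _) , s≤s (s≤s ()) , _)

∼ᶜ-pair-sym : ∀ {x y u v} → (x ∷ y ∷ []) ∼ᶜ (u ∷ v ∷ []) → (u ∷ v ∷ []) ∼ᶜ (x ∷ y ∷ [])
∼ᶜ-pair-sym xy∼uv with ∼ᶜ-pair-cases xy∼uv
... | inj₁ refl = ∼ᶜ-pair-refl
... | inj₂ refl = ∼ᶜ-pair-swap

∼ᶜ-pair-trans : ∀ {x y u v w z} → (x ∷ y ∷ []) ∼ᶜ (u ∷ v ∷ []) → (u ∷ v ∷ []) ∼ᶜ (w ∷ z ∷ []) →
                (x ∷ y ∷ []) ∼ᶜ (w ∷ z ∷ [])
∼ᶜ-pair-trans xy∼uv uv∼wz with ∼ᶜ-pair-cases xy∼uv | ∼ᶜ-pair-cases uv∼wz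
... | inj₁ refl | _         = uv∼wz
... | inj₂ refl | inj₁ refl = ∼ᶜ-pair-swap
... | inj₂ refl | inj₂ refl = ∼ᶜ-pair-refl

adjacent-pair : ∀ {m a b} → a ≡ m ⊎ a ≡ suc m → b ≡ m ⊎ b ≡ suc m → b ≢ a → (a ∷ b ∷ []) ∼ᶜ (m ∷ suc m ∷ [])
adjacent-pair (inj₁ refl) (inj₁ refl) b≢a = contradiction refl b≢a
adjacent-pair (inj₁ refl) (inj₂ refl) _   = ∼ᶜ-pair-refl
adjacent-pair (inj₂ refl) (inj₁ refl) _   = ∼ᶜ-pair-swap
adjacent-pair (inj₂ refl) (inj₂ refl) b≢a = contradiction refl b≢a

∼ᶜ-length : ∀ {xs ys} → xs ∼ᶜ ys → length xs ≡ length ys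
∼ᶜ-length {xs} (k , _ , refl) =
  sym (trans (length-++-comm (drop k xs) (take k xs)) (cong length (take++drop≡id k xs)))

length-necklaceSeq : ∀ π s → length (necklaceSeq π s) ≡ s
length-necklaceSeq π s = trans (length-map _ (upTo s)) (length-upTo s)

necklace-of-size-2 : ∀ {a b π} → IsTopdropNecklaceOf (a ∷ b ∷ []) π →
                     topdrop (topdrop π) ≡ π × (first π ∷ first (topdrop π) ∷ []) ∼ᶜ (a ∷ b ∷ [])
necklace-of-size-2 {π = π} (s , (_ , T^sπ≡π , _) , seq∼ab)
  with trans (sym (length-necklaceSeq π s)) (∼ᶜ-length seq∼ab)
... | refl = T^sπ≡π , seq∼ab

2-cycle-necklace : ∀ {π N} → topdrop (topdrop π) ≡ π → topdrop π ≢ π →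
                   (first π ∷ first (topdrop π) ∷ []) ∼ᶜ N → IsTopdropNecklaceOf N π
2-cycle-necklace {π} T²π≡π Tπ≢π seq∼N = 2 , (s≤s z≤n , T²π≡π , not-fixed) , seq∼N
  where
  not-fixed : ∀ t → 1 ≤ t → t < 2 → topdrop^ t π ≢ π
  not-fixed 1             _ _                  = Tπ≢π
  not-fixed (suc (suc _)) _ (s≤s (s≤s ()))

firsts-of-2-cycle : ∀ {n π} → 2 ≤ n → IsPerm n π → topdrop (topdrop π) ≡ π →
                    (first π ∷ first (topdrop π) ∷ []) ∼ᶜ (n ∸ 1 ∷ n ∷ [])
firsts-of-2-cycle {suc m} {π} 2≤n perm T²π≡π =
  adjacent-pair (first-of-2-cycle perm T²π≡π)
                (first-of-2-cycle (IsPerm-topdrop perm) (cong topdrop T²π≡π))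
                (first-topdrop≢first (IsPerm-unique perm) (IsPerm-first perm .proj₁)
                                     (subst (2 ≤_) (sym (IsPerm-length perm)) 2≤n))

topdropValid⇒adjacent : ∀ {n a b} → 2 ≤ n → TopdropValid n (a ∷ b ∷ []) → (a ∷ b ∷ []) ∼ᶜ (n ∸ 1 ∷ n ∷ [])
topdropValid⇒adjacent 2≤n (π , perm , necklace) with necklace-of-size-2 necklace
... | T²π≡π , firsts∼ab = ∼ᶜ-pair-trans (∼ᶜ-pair-sym firsts∼ab) (firsts-of-2-cycle 2≤n perm T²π≡π)

twoCycle : ℕ → List ℕ
twoCycle m = suc m ∷ map suc (upTo m) ++ [ suc (suc m) ]

length-map-suc-upTo : ∀ m → length (map suc (upTo m)) ≡ m
length-map-suc-upTo m = trans (length-map suc (upTo m)) (length-upTo m)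

map-suc-upTo-suc : ∀ m → map suc (upTo (suc m)) ≡ map suc (upTo m) ∷ʳ suc m
map-suc-upTo-suc m = trans (cong (map suc) (sym (upTo-∷ʳ m))) (map-++ suc (upTo m) [ m ])

twoCycle-perm : ∀ m → IsPerm (suc (suc m)) (twoCycle m)
twoCycle-perm m = begin
  suc m ∷ L ++ [ suc (suc m) ]             ↭⟨ shift (suc m) L [ suc (suc m) ] ⟨
  L ++ [ suc m ] ++ [ suc (suc m) ]        ≡⟨ ++-assoc L [ suc m ] [ suc (suc m) ] ⟨
  (L ∷ʳ suc m) ∷ʳ suc (suc m)              ≡⟨ cong (_∷ʳ suc (suc m)) (map-suc-upTo-suc m) ⟨
  map suc (upTo (suc m)) ∷ʳ suc (suc m)    ≡⟨ map-suc-upTo-suc (suc m) ⟨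
  map suc (upTo (suc (suc m)))             ∎
  where
  open PermutationReasoning
  L : List ℕ
  L = map suc (upTo m)

topdrop-twoCycle : ∀ m → topdrop (twoCycle m) ≡ suc (suc m) ∷ reverse (suc m ∷ map suc (upTo m))
topdrop-twoCycle m = topdrop-∷-++ (map suc (upTo m)) [ suc (suc m) ] (length-map-suc-upTo m)

topdrop²-twoCycle : ∀ m → topdrop (topdrop (twoCycle m)) ≡ twoCycle m
topdrop²-twoCycle m = begin
  topdrop (topdrop (twoCycle m)) ≡⟨ cong topdrop (topdrop-twoCycle m) ⟩
  topdrop (N ∷ reverse A)        ≡⟨ topdrop-all (N ∷ reverse A) (≤-reflexive |σ|≡N) ⟩
  reverse (N ∷ reverse A)        ≡⟨ unfold-reverse N (reverse A) ⟩
  reverse (reverse A) ∷ʳ N       ≡⟨ cong (_∷ʳ N) (reverse-involutive A) ⟩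
  A ∷ʳ N                         ∎
  where
  open ≡-Reasoning
  N : ℕ
  N = suc (suc m)
  A : List ℕ
  A = suc m ∷ map suc (upTo m)
  |σ|≡N : length (N ∷ reverse A) ≡ N
  |σ|≡N = cong suc (trans (length-reverse A) (cong suc (length-map-suc-upTo m)))

adjacent⇒topdropValid : ∀ {n a b} → 2 ≤ n → (a ∷ b ∷ []) ∼ᶜ (n ∸ 1 ∷ n ∷ []) → TopdropValid n (a ∷ b ∷ [])
adjacent⇒topdropValid {suc (suc m)} {a} {b} (s≤s (s≤s _)) ab∼ =
  twoCycle m , twoCycle-perm m , 2-cycle-necklace (topdrop²-twoCycle m) Tπ≢π firsts∼ab
  where
  σ₁≡N : first (topdrop (twoCycle m)) ≡ suc (suc m)
  σ₁≡N = cong first (topdrop-twoCycle m)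
  Tπ≢π : topdrop (twoCycle m) ≢ twoCycle m
  Tπ≢π Tπ≡π = 1+n≢n (trans (sym σ₁≡N) (cong first Tπ≡π))
  firsts∼ab : (suc m ∷ first (topdrop (twoCycle m)) ∷ []) ∼ᶜ (a ∷ b ∷ [])
  firsts∼ab = subst (λ σ₁ → (suc m ∷ σ₁ ∷ []) ∼ᶜ (a ∷ b ∷ [])) (sym σ₁≡N) (∼ᶜ-pair-sym ab∼)

lemma4p6 : (n : ℕ) → 2 ≤ n → (a b : ℕ) →
    TopdropValid n (a ∷ b ∷ []) ⇔ ((a ∷ b ∷ []) ∼ᶜ ((n ∸ 1) ∷ n ∷ []))
lemma4p6 n 2≤n a b = mk⇔ (topdropValid⇒adjacent 2≤n) (adjacent⇒topdropValid 2≤n)
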